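{- Fix $b\in\mathbb{N}$ and let $P$ be a $b$-pattern. Then $P$ is realizable in $L=\mathbb{N}\times\mathbb{N}$ if and only if, for every prime $p$, the set $C$ of points of $P$ assigned a circle fails to contain a complete rectangle modulo $(p,p^b)$.
   Context: Let $\mathbb{N}=\{1,2,3,\dots\}$ and $L=\mathbb{N}\times\mathbb{N}$. For $b\in\mathbb{N}$, $\gcd_b(r,s)=\max\{k\in\mathbb{N}: k\mid r \text{ and } k^b\mid s\}$, and a point $(r,s)\in L$ is called $b$-visible if $\gcd_b(r,s)=1$ and $b$-invisible otherwise. A $b$-pattern $P$ is obtained by fixing a positive integer $w$ and assigning to each $(r,s)\in L$ with $1\le r\le w$, $1\le s\le w^b$ either a circle, a cross, or neither. $P$ is realizable in $L$ if there exists $(u,v)\in L$ such that for every $(r,s)$ of $P$ assigned a circle, $(u+r,v+s)$ is $b$-visible, and for every $(r,s)$ of $P$ assigned a cross, $(u+r,v+s)$ is $b$-invisible. For a positive integer $m$, a complete rectangle modulo $(m,m^b)$ is a collection of $m^{b+1}$ points of $L$ containing a complete system of residues of $\mathbb{Z}/m\mathbb{Z}\times\mathbb{Z}/m^b\mathbb{Z}$ (i.e. reducing the first coordinate mod $m$ and the second mod $m^b$); a set contains a complete rectangle modulo $(m,m^b)$ if it contains such a collection, equivalently if its points represent every class of $\mathbb{Z}/m\mathbb{Z}\times\mathbb{Z}/m^b\mathbb{Z}$. -}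

module Defs where

open import Data.Nat using (ℕ; zero; suc; _+_; _*_; _^_; _≤_; _<_; NonZero)
open import Data.Nat.Divisibility using (_∣_)
open import Data.Nat.Primality using (Prime)
open import Data.Fin using (Fin; toℕ)
open import Data.Product using (Σ; ∃; _×_; _,_)
open import Relation.Binary.PropositionalEquality using (_≡_)
open import Relation.Nullary using (¬_)

IsGcdB : ℕ → ℕ → ℕ → ℕ → Set
IsGcdB b r s g = (1 ≤ g × g ∣ r × (g ^ b) ∣ s)
               × (∀ k → 1 ≤ k → k ∣ r → (k ^ b) ∣ s → k ≤ g)

Visible : ℕ → ℕ → ℕ → Set
Visible b r s = IsGcdB b r s 1

Invisible : ℕ → ℕ → ℕ → Set
Invisible b r s = ¬ Visible b r s

data Mark : Set where
  circle cross none : Mark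

-- a b-pattern of width w: the point (toℕ i + 1, toℕ j + 1) gets mark P i j,
-- i.e. all (r,s) with 1 ≤ r ≤ w, 1 ≤ s ≤ w^b
Pattern : ℕ → ℕ → Set
Pattern b w = Fin w → Fin (w ^ b) → Mark

Realizable : (b w : ℕ) → Pattern b w → Set
Realizable b w P =
  Σ ℕ λ u → Σ ℕ λ v → 1 ≤ u × 1 ≤ v ×
    (∀ (i : Fin w) (j : Fin (w ^ b)) →
       (P i j ≡ circle → Visible b (u + (toℕ i + 1)) (v + (toℕ j + 1)))
     × (P i j ≡ cross → Invisible b (u + (toℕ i + 1)) (v + (toℕ j + 1))))

-- the circle set C of P contains a complete rectangle modulo (m, m^b):
-- every residue class of ℤ/m × ℤ/m^b is represented by a circle point
ContainsCompleteRect : (b w : ℕ) → Pattern b w → (m : ℕ) → Set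
ContainsCompleteRect b w P m =
  ∀ x y → x < m → y < m ^ b →
    Σ (Fin w) λ i → Σ (Fin (w ^ b)) λ j →
      P i j ≡ circle
      × (∃ λ q → toℕ i + 1 ≡ x + q * m)
      × (∃ λ q → toℕ j + 1 ≡ y + q * (m ^ b))

-- If (u, v) realizes P and C meets every class modulo (p, p^b), the circle lying in the class of
-- (-u, -v) is moved onto a point divisible by (p, p^b), which is invisible.  Conversely, choose for
-- every prime p ≤ w a class (a, c) modulo (p, p^b) missed by C, and for every cross (r, s) a fresh
-- prime q > w.  The Chinese remainder theorem gives u ≡ -a (mod p), u ≡ -r (mod q), and then
-- v ≡ -c (mod p^b), v ≡ -s (mod q^b), v ≡ 0 modulo p'^b for every other prime p' ≤ u + w.  Each
-- cross is blocked by its q.  A prime blocking a circle (r, s) is either some p ≤ w, excluded by the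
-- choice of class, or some q, which forces (r, s) to be the cross of q because r, s < q, q^b, or
-- else it is a prime p' > w with p'^b ∣ v, so p'^b ∣ s ≤ w^b, which is impossible.
module Submission where

open import Data.Empty using (⊥; ⊥-elim)
open import Data.Fin using (Fin; toℕ; fromℕ<)
open import Data.Fin.Properties using (toℕ<n; toℕ-fromℕ<; toℕ-injective; ¬∀⟶∃¬; any?; all?)
open import Data.List using (List; []; _∷_; map; filter; _++_; upTo; cartesianProduct; allFin)
open import Data.List.Membership.Propositional using (_∈_; _∉_)
open import Data.List.Membership.Propositional.Properties
  using (∈-map⁺; ∈-map⁻; ∈-filter⁺; ∈-filter⁻; ∈-++⁺ˡ; ∈-++⁺ʳ; ∈-++⁻; ∈-upTo⁺; ∈-upTo⁻;
         ∈-cartesianProduct⁺; ∈-allFin)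
open import Data.List.Relation.Unary.All as All using (All; []; _∷_)
open import Data.List.Relation.Unary.All.Properties using () renaming (map⁺ to All-map⁺; map⁻ to All-map⁻)
open import Data.List.Relation.Unary.AllPairs as AllPairs using (AllPairs; []; _∷_)
import Data.List.Relation.Unary.AllPairs.Properties as AllPairs
open import Data.List.Relation.Unary.Any using (here; there)
open import Data.List.Relation.Unary.Unique.Propositional using (Unique)
open import Data.List.Relation.Unary.Unique.Propositional.Properties using (upTo⁺)
open import Data.Nat
open import Data.Nat.Coprimality using (Coprime; coprime-Bézout)
open import Data.Nat.Divisibility
open import Data.Nat.DivMod using (_%_; _/_; m≡m%n+[m/n]*n; [m+kn]%n≡m%n; m%n<n; m<n⇒m%n≡m)
open import Data.Nat.GCD using (module Bézout)
open import Data.Nat.ListAction using (product)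
open import Data.Nat.ListAction.Properties using (∈⇒∣product)
open import Data.Nat.Primality
open import Data.Nat.Primality.Factorisation using (factorise; factorisationHasAllPrimeFactors)
open import Data.Nat.Properties
open import Data.Nat.Tactic.RingSolver using (solve-∀)
open import Algebra.Properties.CommutativeSemigroup +-commutativeSemigroup using (x∙yz≈z∙yx; x∙yz≈z∙xy)
open import Data.List.Membership.DecPropositional _≟_ using (_∈?_; _∉?_)
open import Data.Product using (∃; ∃₂; _×_; _,_; proj₁; proj₂; map₂)
open import Data.Sum using (_⊎_; inj₁; inj₂; [_,_]′)
open import Function using (id; _∘_; _on_)
open import Function.Bundles using (_⇔_; mk⇔)
open import Relation.Nullary using (¬_; Dec; yes; no; contradiction)
open import Relation.Nullary.Decidable using (_×-dec_)
open import Relation.Binary.PropositionalEquality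

open import Defs

private variable m n k p q r s : ℕ

prime>1 : Prime p → 1 < p
prime>1 {p} pp = nonTrivial⇒n>1 p {{prime⇒nonTrivial pp}}

prime∣prime⇒≡ : Prime p → Prime q → p ∣ q → p ≡ q
prime∣prime⇒≡ pp pq p∣q with prime⇒irreducible pq p∣q
... | inj₁ refl = contradiction (prime>1 pp) (<-irrefl refl)
... | inj₂ p≡q  = p≡q

prime∣m^n⇒prime∣m : ∀ n → Prime p → p ∣ m ^ n → p ∣ m
prime∣m^n⇒prime∣m zero    pp p∣1 = contradiction (∣1⇒≡1 p∣1) (>⇒≢ (prime>1 pp))
prime∣m^n⇒prime∣m {m = m} (suc n) pp p∣m*m^n =
  [ id , prime∣m^n⇒prime∣m n pp ]′ (euclidsLemma m (m ^ n) pp p∣m*m^n)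

∣⇒^∣^ : ∀ n → m ∣ k → m ^ n ∣ k ^ n
∣⇒^∣^ zero    _   = ∣-refl
∣⇒^∣^ (suc n) m∣k = *-pres-∣ m∣k (∣⇒^∣^ n m∣k)

∃-prime∣ : 1 < n → ∃ λ p → Prime p × p ∣ n
∃-prime∣ {n} 1<n with factorise n {{>-nonZero (<-trans z<s 1<n)}}
... | record { factors = [] ; isFactorisation = n≡1 } = contradiction n≡1 (>⇒≢ 1<n)
... | record { factors = p ∷ ps ; isFactorisation = n≡p*ps ; factorsPrime = pp ∷ _ } =
  p , pp , subst (p ∣_) (sym n≡p*ps) (m∣m*n (product ps))

-- Euclid: a prime factor of n ! + 1 divides no number up to n.
∃-prime> : ∀ n → ∃ λ p → Prime p × n < p
∃-prime> n with ∃-prime∣ (s≤s (1≤n! n))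
... | p , pp , p∣n!+1 with p ≤? n
...   | no  p≰n = p , pp , ≰⇒> p≰n
...   | yes p≤n = contradiction (∣1⇒≡1 p∣1) (>⇒≢ (prime>1 pp))
  where
  n∣n! : ∀ n → .{{NonZero n}} → n ∣ n !
  n∣n! (suc n) = m∣m*n (n !)
  p∣1 : p ∣ 1
  p∣1 = ∣m+n∣m⇒∣n (subst (p ∣_) (+-comm 1 (n !)) p∣n!+1)
                  (∣-trans (n∣n! p {{prime⇒nonZero pp}}) (m≤n⇒m!∣n! p≤n))

primesUpTo : ℕ → List ℕ
primesUpTo n = filter prime? (upTo (suc n))

∈-primesUpTo⁺ : ∀ n → Prime p → p ≤ n → p ∈ primesUpTo n
∈-primesUpTo⁺ n pp p≤n = ∈-filter⁺ prime? (∈-upTo⁺ (s≤s p≤n)) pp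

∈-primesUpTo⁻ : ∀ n → p ∈ primesUpTo n → Prime p × p ≤ n
∈-primesUpTo⁻ n p∈ with p∈upTo , pp ← ∈-filter⁻ prime? p∈ = pp , ≤-pred (∈-upTo⁻ p∈upTo)

primesUpTo-unique : ∀ n → Unique (primesUpTo n)
primesUpTo-unique n = AllPairs.filter⁺ prime? (upTo⁺ (suc n))

module _ {a} {A : Set a} where

  freshPrimes : ℕ → List A → List (ℕ × A)
  freshPrimes B []       = []
  freshPrimes B (x ∷ xs) = (B′ , x) ∷ freshPrimes B′ xs
    where B′ = proj₁ (∃-prime> B)

  freshPrimes-prime : ∀ B xs → All (λ t → Prime (proj₁ t) × B < proj₁ t) (freshPrimes B xs)
  freshPrimes-prime B []       = []
  freshPrimes-prime B (x ∷ xs) with q , pq , B<q ← ∃-prime> B =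
    (pq , B<q) ∷ All.map (λ (pt , q<t) → pt , <-trans B<q q<t) (freshPrimes-prime q xs)

  freshPrimes-distinct : ∀ B xs → AllPairs (_≢_ on proj₁) (freshPrimes B xs)
  freshPrimes-distinct B []       = []
  freshPrimes-distinct B (x ∷ xs) =
    All.map (λ (_ , q<t) → <⇒≢ q<t) (freshPrimes-prime _ xs) ∷ freshPrimes-distinct _ xs

  ∈-freshPrimes⁺ : ∀ {x} B {xs} → x ∈ xs → ∃ λ q → (q , x) ∈ freshPrimes B xs
  ∈-freshPrimes⁺ B (here refl)  = _ , here refl
  ∈-freshPrimes⁺ B (there x∈xs) = map₂ there (∈-freshPrimes⁺ _ x∈xs)

  ∈-freshPrimes⁻ : ∀ {t} B {xs} → t ∈ freshPrimes B xs → proj₂ t ∈ xs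
  ∈-freshPrimes⁻ B {_ ∷ _} (here refl) = here refl
  ∈-freshPrimes⁻ B {_ ∷ _} (there t∈) = there (∈-freshPrimes⁻ _ t∈)

¬common-prime⇒coprime : (∀ {p} → Prime p → p ∣ m → p ∣ n → ⊥) → Coprime m n
¬common-prime⇒coprime h {zero} (0∣m , 0∣n)
  rewrite 0∣⇒≡0 0∣m | 0∣⇒≡0 0∣n = ⊥-elim (h prime[2] (2 ∣0) (2 ∣0))
¬common-prime⇒coprime h {1} _ = refl
¬common-prime⇒coprime h {d@(suc (suc _))} (d∣m , d∣n) with p , pp , p∣d ← ∃-prime∣ {d} (s≤s (s≤s z≤n)) =
  ⊥-elim (h pp (∣-trans p∣d d∣m) (∣-trans p∣d d∣n))

coprime⇒¬common-prime : Coprime m n → Prime p → p ∣ m → p ∣ n → ⊥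
coprime⇒¬common-prime m⊥n pp p∣m p∣n = contradiction (m⊥n (p∣m , p∣n)) (>⇒≢ (prime>1 pp))

≢⇒coprime : Prime p → Prime q → p ≢ q → Coprime p q
≢⇒coprime pp pq p≢q = ¬common-prime⇒coprime λ rp r∣p r∣q →
  p≢q (trans (sym (prime∣prime⇒≡ rp pp r∣p)) (prime∣prime⇒≡ rp pq r∣q))

distinct-primes⇒coprime : ∀ {a} {A : Set a} {f : A → ℕ} {xs} →
                          All (Prime ∘ f) xs → AllPairs (_≢_ on f) xs → AllPairs (Coprime on f) xs
distinct-primes⇒coprime []         []           = []
distinct-primes⇒coprime (px ∷ pxs) (x≢xs ∷ xs≢) =
  All.zipWith (λ (py , x≢y) {d} → ≢⇒coprime px py x≢y {d}) (pxs , x≢xs)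
  ∷ distinct-primes⇒coprime pxs xs≢

coprime-^ : ∀ i j → Coprime m n → Coprime (m ^ i) (n ^ j)
coprime-^ i j m⊥n = ¬common-prime⇒coprime λ pp p∣m^i p∣n^j →
  coprime⇒¬common-prime m⊥n pp (prime∣m^n⇒prime∣m i pp p∣m^i) (prime∣m^n⇒prime∣m j pp p∣n^j)

coprime-product : ∀ {ns} → All (Coprime m) ns → Coprime m (product ns)
coprime-product []                       = ∣1⇒≡1 ∘ proj₂
coprime-product {ns = n ∷ ns} (m⊥n ∷ m⊥ns) = ¬common-prime⇒coprime λ pp p∣m p∣n*ns →
  [ coprime⇒¬common-prime m⊥n pp p∣m , coprime⇒¬common-prime (coprime-product m⊥ns) pp p∣m ]′
    (euclidsLemma n (product ns) pp p∣n*ns)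

coprime⇒m∣1+n*y : .{{NonZero m}} → Coprime m n → ∃ λ y → m ∣ 1 + n * y
coprime⇒m∣1+n*y {m} {n} m⊥n with coprime-Bézout m⊥n
... | Bézout.+- x y 1+y*n≡x*m = y , divides x (trans (cong (1 +_) (*-comm n y)) 1+y*n≡x*m)
coprime⇒m∣1+n*y {suc k} {n} m⊥n | Bézout.-+ x y 1+x*m≡y*n = k * y , divides (1 + k * x) (begin
  1 + n * (k * y)          ≡⟨ cong (1 +_) (lemma₁ n k y) ⟩
  1 + k * (y * n)          ≡⟨ cong (λ z → 1 + k * z) 1+x*m≡y*n ⟨
  1 + k * (1 + x * suc k)  ≡⟨ lemma₂ k x ⟩
  (1 + k * x) * suc k      ∎)
  where
  open ≡-Reasoning
  lemma₁ : ∀ n k y → n * (k * y) ≡ k * (y * n)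
  lemma₁ = solve-∀
  lemma₂ : ∀ k x → 1 + k * (1 + x * suc k) ≡ (1 + k * x) * suc k
  lemma₂ = solve-∀

∃-additive-inverse : ∀ m .{{_ : NonZero m}} u → ∃ λ x → x < m × m ∣ u + x
∃-additive-inverse (suc k) u = x , m%n<n (k * u) (suc k) ,
  ∣m+n∣m⇒∣n (subst (suc k ∣_) (u*m≡Q*m+[u+x] (m≡m%n+[m/n]*n (k * u) (suc k))) (n∣m*n u)) (n∣m*n Q)
  where
  x = (k * u) % suc k
  Q = (k * u) / suc k
  u*m≡Q*m+[u+x] : k * u ≡ x + Q * suc k → u * suc k ≡ Q * suc k + (u + x)
  u*m≡Q*m+[u+x] k*u≡x+Q*m = begin
    u * suc k            ≡⟨ *-suc u k ⟩
    u + u * k            ≡⟨ cong (u +_) (*-comm u k) ⟩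
    u + k * u            ≡⟨ cong (u +_) k*u≡x+Q*m ⟩
    u + (x + Q * suc k)  ≡⟨ x∙yz≈z∙xy u x (Q * suc k) ⟩
    Q * suc k + (u + x)  ∎
    where open ≡-Reasoning

m∣u+r⇒m∣u+s⇒r%m≡s%m : ∀ m .{{_ : NonZero m}} {u r s} → m ∣ u + r → m ∣ u + s → r % m ≡ s % m
m∣u+r⇒m∣u+s⇒r%m≡s%m m {u} {r} {s} (divides i u+r≡i*m) (divides j u+s≡j*m) = begin
  r % m              ≡⟨ [m+kn]%n≡m%n r j m ⟨
  (r + j * m) % m    ≡⟨ cong (λ z → (r + z) % m) u+s≡j*m ⟨
  (r + (u + s)) % m  ≡⟨ cong (_% m) (x∙yz≈z∙yx r u s) ⟩
  (s + (u + r)) % m  ≡⟨ cong (λ z → (s + z) % m) u+r≡i*m ⟩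
  (s + i * m) % m    ≡⟨ [m+kn]%n≡m%n s i m ⟩
  s % m              ∎
  where open ≡-Reasoning

m∣u+r⇒m∣u+s⇒r≡s : ∀ u → r < m → s < m → m ∣ u + r → m ∣ u + s → r ≡ s
m∣u+r⇒m∣u+s⇒r≡s {r} {m} {s} u r<m s<m m∣u+r m∣u+s = begin
  r      ≡⟨ m<n⇒m%n≡m r<m ⟨
  r % m  ≡⟨ m∣u+r⇒m∣u+s⇒r%m≡s%m m m∣u+r m∣u+s ⟩
  s % m  ≡⟨ m<n⇒m%n≡m s<m ⟩
  s      ∎
  where
  open ≡-Reasoning
  instance _ = >-nonZero (<-≤-trans z<s r<m)

m%n≡x⇒m≡x+q*n : ∀ m n .{{_ : NonZero n}} {x} → m % n ≡ x → ∃ λ q → m ≡ x + q * n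
m%n≡x⇒m≡x+q*n m n m%n≡x = m / n , trans (m≡m%n+[m/n]*n m n) (cong (_+ m / n * n) m%n≡x)

m∣u+x⇒m∣u+[x+k*m] : ∀ u x k → m ∣ u + x → m ∣ u + (x + k * m)
m∣u+x⇒m∣u+[x+k*m] {m} u x k m∣u+x =
  subst (m ∣_) (+-assoc u x (k * m)) (∣m∣n⇒∣m+n m∣u+x (n∣m*n k))

-- (m , a) stands for the congruence x ≡ -a (mod m).
_Solves_ : ℕ → ℕ × ℕ → Set
x Solves (m , a) = m ∣ x + a

solves-+ : ∀ {N x} cs → All (λ c → proj₁ c ∣ N) cs → All (x Solves_) cs → All ((N + x) Solves_) cs
solves-+ {N} {x} cs cs∣N x⊨cs = All.zipWith shift (cs∣N , x⊨cs)
  where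
  shift : ∀ {c} → proj₁ c ∣ N × x Solves c → (N + x) Solves c
  shift {m , a} (m∣N , m∣x+a) = subst (m ∣_) (sym (+-assoc N x a)) (∣m∣n⇒∣m+n m∣N m∣x+a)

crt : ∀ cs → All (NonZero ∘ proj₁) cs → AllPairs (Coprime on proj₁) cs →
      ∃ λ x → 0 < x × All (x Solves_) cs
crt [] _ _ = 1 , z<s , []
crt ((m , a) ∷ cs) (m≢0 ∷ cs≢0) (m⊥cs ∷ cs⊥) with x , x>0 , x⊨cs ← crt cs cs≢0 cs⊥
  with y , m∣1+N*y ← coprime⇒m∣1+n*y {{m≢0}} (coprime-product (All-map⁺ m⊥cs)) =
  N * t + x , <-≤-trans x>0 (m≤n+m x (N * t)) ,
  subst (m ∣_) (sym (lemma N x a y)) (∣n⇒∣m*n (x + a) m∣1+N*y)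
  ∷ solves-+ cs (All.tabulate (∣m⇒∣m*n t ∘ ∈⇒∣product ∘ ∈-map⁺ proj₁)) x⊨cs
  where
  N = product (map proj₁ cs)
  t = (x + a) * y
  lemma : ∀ N x a y → N * ((x + a) * y) + x + a ≡ (x + a) * (1 + N * y)
  lemma = solve-∀

visible⇒¬prime-divisor : ∀ b → Visible b r s → Prime p → p ∣ r → p ^ b ∣ s → ⊥
visible⇒¬prime-divisor b (_ , maximal) pp p∣r pᵇ∣s =
  <⇒≱ (prime>1 pp) (maximal _ (<⇒≤ (prime>1 pp)) p∣r pᵇ∣s)

¬prime-divisor⇒visible : ∀ b → (∀ {p} → Prime p → p ∣ r → p ^ b ∣ s → ⊥) → Visible b r s
¬prime-divisor⇒visible {r} {s} b h = (≤-refl , 1∣ r , subst (_∣ s) (sym (^-zeroˡ b)) (1∣ s)) , maximal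
  where
  maximal : ∀ k → 1 ≤ k → k ∣ r → k ^ b ∣ s → k ≤ 1
  maximal k _ k∣r kᵇ∣s with k ≤? 1
  ... | yes k≤1 = k≤1
  ... | no  k≰1 with p , pp , p∣k ← ∃-prime∣ (≰⇒> k≰1) =
    ⊥-elim (h pp (∣-trans p∣k k∣r) (∣-trans (∣⇒^∣^ b p∣k) kᵇ∣s))

toℕ+1≤n : (i : Fin n) → toℕ i + 1 ≤ n
toℕ+1≤n {n} i = subst (_≤ n) (+-comm 1 (toℕ i)) (toℕ<n i)

m∣u+[i+1]⇒m∣u+[j+1]⇒i≡j : ∀ u {i j : Fin n} → n < m →
                          m ∣ u + (toℕ i + 1) → m ∣ u + (toℕ j + 1) → i ≡ j
m∣u+[i+1]⇒m∣u+[j+1]⇒i≡j u {i} {j} n<m m∣u+i+1 m∣u+j+1 =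
  toℕ-injective (+-cancelʳ-≡ 1 _ _ (m∣u+r⇒m∣u+s⇒r≡s u (≤-<-trans (toℕ+1≤n i) n<m)
                                                       (≤-<-trans (toℕ+1≤n j) n<m) m∣u+i+1 m∣u+j+1))

_≟ᴹ_ : (x y : Mark) → Dec (x ≡ y)
circle ≟ᴹ circle = yes refl
cross  ≟ᴹ cross  = yes refl
none   ≟ᴹ none   = yes refl
circle ≟ᴹ cross  = no λ ()
circle ≟ᴹ none   = no λ ()
cross  ≟ᴹ circle = no λ ()
cross  ≟ᴹ none   = no λ ()
none   ≟ᴹ circle = no λ ()
none   ≟ᴹ cross  = no λ ()

module _ {b w : ℕ} (P : Pattern b w) where

  realizable⇒¬complete : Realizable b w P → ∀ p → Prime p → ¬ ContainsCompleteRect b w P p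
  realizable⇒¬complete (u , v , _ , _ , realizes) p pp complete
    with x , x<p , p∣u+x ← ∃-additive-inverse p {{prime⇒nonZero pp}} u
       | y , y<pᵇ , pᵇ∣v+y ← ∃-additive-inverse (p ^ b) {{m^n≢0 p b {{prime⇒nonZero pp}}}} v
    with i , j , circ , (k , r≡x+kp) , (l , s≡y+lpᵇ) ← complete x y x<p y<pᵇ =
    visible⇒¬prime-divisor b (proj₁ (realizes i j) circ) pp
      (subst (λ r → p ∣ u + r) (sym r≡x+kp) (m∣u+x⇒m∣u+[x+k*m] u x k p∣u+x))
      (subst (λ s → p ^ b ∣ v + s) (sym s≡y+lpᵇ) (m∣u+x⇒m∣u+[x+k*m] v y l pᵇ∣v+y))

  -- The class of (a, c) modulo (m, m^b) contains no circle, in the form it is used: a shift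
  -- (u, v) ≡ (-a, -c) moves no circle onto a point (r, s) with m ∣ r and m^b ∣ s.
  Avoiding : ℕ → ℕ → ℕ → Set
  Avoiding m a c = ∀ {u v} i j → P i j ≡ circle →
    m ∣ u + a → m ∣ u + (toℕ i + 1) → m ^ b ∣ v + c → m ^ b ∣ v + (toℕ j + 1) → ⊥

  module _ (m : ℕ) .{{_ : NonZero m}} where
    private instance
      mᵇ≢0 : NonZero (m ^ b)
      mᵇ≢0 = m^n≢0 m b

    CircleIn : ℕ → ℕ → Set
    CircleIn x y = ∃₂ λ i j → P i j ≡ circle × (toℕ i + 1) % m ≡ x × (toℕ j + 1) % m ^ b ≡ y

    circleIn? : ∀ x y → Dec (CircleIn x y)
    circleIn? x y = any? λ i → any? λ j →
      (P i j ≟ᴹ circle) ×-dec ((toℕ i + 1) % m ≟ x) ×-dec ((toℕ j + 1) % m ^ b ≟ y)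

    circle-in-every-class⇒complete : (∀ (x : Fin m) (y : Fin (m ^ b)) → CircleIn (toℕ x) (toℕ y)) →
                                     ContainsCompleteRect b w P m
    circle-in-every-class⇒complete circleIn x y x<m y<mᵇ
      with i , j , circ , r%m≡x , s%mᵇ≡y ← subst₂ CircleIn (toℕ-fromℕ< x<m) (toℕ-fromℕ< y<mᵇ)
                                                     (circleIn (fromℕ< x<m) (fromℕ< y<mᵇ)) =
      i , j , circ , m%n≡x⇒m≡x+q*n _ m r%m≡x , m%n≡x⇒m≡x+q*n _ (m ^ b) s%mᵇ≡y

    ¬complete⇒avoiding : ¬ ContainsCompleteRect b w P m → ∃₂ (Avoiding m)
    ¬complete⇒avoiding ¬complete
      with x , ¬∀y ← ¬∀⟶∃¬ m _ (λ x → all? λ y → circleIn? (toℕ x) (toℕ y))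
                                (¬complete ∘ circle-in-every-class⇒complete)
      with y , ¬circleIn ← ¬∀⟶∃¬ (m ^ b) _ (λ y → circleIn? (toℕ x) (toℕ y)) ¬∀y =
      toℕ x , toℕ y , λ i j circ m∣u+a m∣u+r mᵇ∣v+c mᵇ∣v+s →
        ¬circleIn (i , j , circ , r%n≡z m∣u+r m∣u+a , r%n≡z mᵇ∣v+s mᵇ∣v+c)
      where
      r%n≡z : ∀ {n u r} .{{_ : NonZero n}} {z : Fin n} → n ∣ u + r → n ∣ u + toℕ z → r % n ≡ toℕ z
      r%n≡z {n} {z = z} n∣u+r n∣u+z =
        trans (m∣u+r⇒m∣u+s⇒r%m≡s%m n n∣u+r n∣u+z) (m<n⇒m%n≡m (toℕ<n z))

  module Construction (b≥1 : 1 ≤ b) (¬complete : ∀ p → Prime p → ¬ ContainsCompleteRect b w P p) where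

    avoidance : ℕ → ℕ × ℕ
    avoidance p with prime? p
    ... | yes pp = let a , c , _ = ¬complete⇒avoiding p {{prime⇒nonZero pp}} (¬complete p pp) in a , c
    ... | no  _  = 0 , 0

    avoidance-avoids : Prime p → Avoiding p (proj₁ (avoidance p)) (proj₂ (avoidance p))
    avoidance-avoids {p} pp with prime? p
    ... | yes pp′ = proj₂ (proj₂ (¬complete⇒avoiding p {{prime⇒nonZero pp′}} (¬complete p pp′)))
    ... | no  ¬pp = contradiction pp ¬pp

    -- The target (q , a , c) asks for u ≡ -a (mod q) and v ≡ -c (mod q ^ b).
    Target : Set
    Target = ℕ × ℕ × ℕ

    uCongruence vCongruence : Target → ℕ × ℕ
    uCongruence t = proj₁ t , proj₁ (proj₂ t)
    vCongruence t = proj₁ t ^ b , proj₂ (proj₂ t)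

    points : List (Fin w × Fin (w ^ b))
    points = cartesianProduct (allFin w) (allFin (w ^ b))

    isCross? : ∀ ((i , j) : Fin w × Fin (w ^ b)) → Dec (P i j ≡ cross)
    isCross? (i , j) = P i j ≟ᴹ cross

    crossPoints : List (Fin w × Fin (w ^ b))
    crossPoints = filter isCross? points

    smallTargets crossTargets plan : List Target
    smallTargets = map (λ p → p , avoidance p) (primesUpTo w)
    crossTargets = map (λ (q , i , j) → q , toℕ i + 1 , toℕ j + 1) (freshPrimes w crossPoints)
    plan         = smallTargets ++ crossTargets

    HitsCross : Target → Set
    HitsCross (q , a , c) = w < q × ∃₂ λ i j → P i j ≡ cross × a ≡ toℕ i + 1 × c ≡ toℕ j + 1

    Valid : Target → Set
    Valid (q , a , c) = Prime q × (Avoiding q a c ⊎ HitsCross (q , a , c))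

    plan-valid : ∀ {t} → t ∈ plan → Valid t
    plan-valid t∈plan with ∈-++⁻ smallTargets t∈plan
    ... | inj₁ t∈small with p , p∈ , refl ← ∈-map⁻ _ t∈small =
      let pp = proj₁ (∈-primesUpTo⁻ w p∈) in pp , inj₁ (avoidance-avoids pp)
    ... | inj₂ t∈cross with (q , i , j) , qij∈ , refl ← ∈-map⁻ _ t∈cross =
      let pq , w<q     = All.lookup (freshPrimes-prime w crossPoints) qij∈
          _ , ij-cross = ∈-filter⁻ isCross? {xs = points} (∈-freshPrimes⁻ w qij∈)
      in pq , inj₂ (w<q , i , j , ij-cross , refl , refl)

    plan-prime : All (Prime ∘ proj₁) plan
    plan-prime = All.tabulate (proj₁ ∘ plan-valid)

    plan-distinct : AllPairs (_≢_ on proj₁) plan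
    plan-distinct = AllPairs.++⁺ (AllPairs.map⁺ (primesUpTo-unique w))
                                 (AllPairs.map⁺ (freshPrimes-distinct w crossPoints)) small≢cross
      where
      small≢cross : All (λ s → All (λ t → proj₁ s ≢ proj₁ t) crossTargets) smallTargets
      small≢cross = All-map⁺ (All.tabulate λ p∈ → All-map⁺ (All.map
        (λ (_ , w<q) → <⇒≢ (≤-<-trans (proj₂ (∈-primesUpTo⁻ w p∈)) w<q))
        (freshPrimes-prime w crossPoints)))

    plan-coprime : AllPairs (Coprime on proj₁) plan
    plan-coprime = distinct-primes⇒coprime plan-prime plan-distinct

    planPrimes : List ℕ
    planPrimes = map proj₁ plan

    small-prime∈plan : Prime p → p ≤ w → p ∈ planPrimes
    small-prime∈plan pp p≤w =
      ∈-map⁺ proj₁ (∈-++⁺ˡ (∈-map⁺ (λ p → p , avoidance p) (∈-primesUpTo⁺ w pp p≤w)))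

    module _ (u : ℕ) (u-solves-all : All (u Solves_) (map uCongruence plan)) where

      u-solves : ∀ {t} → t ∈ plan → proj₁ t ∣ u + proj₁ (proj₂ t)
      u-solves = All.lookup (All-map⁻ u-solves-all)

      -- Every prime dividing some u + r with r ≤ w is at most u + w.
      unplanned : List ℕ
      unplanned = filter (_∉? planPrimes) (primesUpTo (u + w))

      unplanned-prime : All Prime unplanned
      unplanned-prime =
        All.tabulate (proj₁ ∘ ∈-primesUpTo⁻ (u + w) ∘ proj₁ ∘ ∈-filter⁻ (_∉? planPrimes))

      S : ℕ
      S = product unplanned

      S-coprime : All (Coprime S ∘ proj₁) plan
      S-coprime = All.tabulate λ t∈plan → ¬common-prime⇒coprime λ pr r∣S r∣q →
        let r∈unplanned = factorisationHasAllPrimeFactors pr r∣S unplanned-prime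
            r∉plan      = proj₂ (∈-filter⁻ (_∉? planPrimes) {xs = primesUpTo (u + w)} r∈unplanned)
        in r∉plan (subst (_∈ planPrimes) (sym (prime∣prime⇒≡ pr (All.lookup plan-prime t∈plan) r∣q))
                         (∈-map⁺ proj₁ t∈plan))

      vSystem : List (ℕ × ℕ)
      vSystem = (S ^ b , 0) ∷ map vCongruence plan

      vSystem-nonZero : All (NonZero ∘ proj₁) vSystem
      vSystem-nonZero = m^n≢0 S b {{productOfPrimes≢0 unplanned-prime}}
                      ∷ All-map⁺ (All.map (λ pq → m^n≢0 _ b {{prime⇒nonZero pq}}) plan-prime)

      vSystem-coprime : AllPairs (Coprime on proj₁) vSystem
      vSystem-coprime = All-map⁺ (All.map (coprime-^ b b) S-coprime)
                      ∷ AllPairs.map⁺ (AllPairs.map (coprime-^ b b) plan-coprime)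

      module _ (v : ℕ) (v-solves-all : All (v Solves_) vSystem) where

        v-solves : ∀ {t} → t ∈ plan → proj₁ t ^ b ∣ v + proj₂ (proj₂ t)
        v-solves = All.lookup (All-map⁻ (All.tail v-solves-all))

        Sᵇ∣v : S ^ b ∣ v
        Sᵇ∣v = subst (S ^ b ∣_) (+-identityʳ v) (All.head v-solves-all)

        planned-prime-harmless : ∀ {t i j} → t ∈ plan → P i j ≡ circle →
                                 proj₁ t ∣ u + (toℕ i + 1) → proj₁ t ^ b ∣ v + (toℕ j + 1) → ⊥
        planned-prime-harmless {t} {i} {j} t∈plan circ q∣u+r qᵇ∣v+s with plan-valid t∈plan
        ... | _ , inj₁ avoiding = avoiding i j circ (u-solves t∈plan) q∣u+r (v-solves t∈plan) qᵇ∣v+s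
        ... | _ , inj₂ (w<q , i′ , j′ , cross′ , refl , refl) =
          circle≢cross (trans (sym circ) (trans (cong₂ P i≡i′ j≡j′) cross′))
          where
          circle≢cross : circle ≢ cross
          circle≢cross ()
          i≡i′ : i ≡ i′
          i≡i′ = m∣u+[i+1]⇒m∣u+[j+1]⇒i≡j u w<q q∣u+r (u-solves t∈plan)
          j≡j′ : j ≡ j′
          j≡j′ = m∣u+[i+1]⇒m∣u+[j+1]⇒i≡j v (^-monoˡ-< b {{>-nonZero b≥1}} w<q)
                                            qᵇ∣v+s (v-solves t∈plan)

        unplanned-prime-harmless : ∀ {i j} → Prime p → p ∉ planPrimes →
                                   p ∣ u + (toℕ i + 1) → p ^ b ∣ v + (toℕ j + 1) → ⊥
        unplanned-prime-harmless {p} {i} {j} pp p∉plan p∣u+r pᵇ∣v+s with p ≤? w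
        ... | yes p≤w = p∉plan (small-prime∈plan pp p≤w)
        ... | no  p≰w = <⇒≱ (^-monoˡ-< b {{>-nonZero b≥1}} (≰⇒> p≰w))
                            (≤-trans (∣⇒≤ {{>-nonZero (m≤n+m 1 (toℕ j))}} pᵇ∣s) (toℕ+1≤n j))
          where
          p≤u+w : p ≤ u + w
          p≤u+w = ≤-trans (∣⇒≤ {{>-nonZero (≤-trans (m≤n+m 1 (toℕ i)) (m≤n+m _ u))}} p∣u+r)
                          (+-monoʳ-≤ u (toℕ+1≤n i))
          p∈unplanned : p ∈ unplanned
          p∈unplanned = ∈-filter⁺ (_∉? planPrimes) (∈-primesUpTo⁺ (u + w) pp p≤u+w) p∉plan
          pᵇ∣v : p ^ b ∣ v
          pᵇ∣v = ∣-trans (∣⇒^∣^ b (∈⇒∣product p∈unplanned)) Sᵇ∣v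
          pᵇ∣s : p ^ b ∣ toℕ j + 1
          pᵇ∣s = ∣m+n∣m⇒∣n pᵇ∣v+s pᵇ∣v

        circle-visible : ∀ {i j} → P i j ≡ circle → Visible b (u + (toℕ i + 1)) (v + (toℕ j + 1))
        circle-visible {i} {j} circ = ¬prime-divisor⇒visible b harmless
          where
          harmless : Prime p → p ∣ u + (toℕ i + 1) → p ^ b ∣ v + (toℕ j + 1) → ⊥
          harmless {p} pp p∣u+r pᵇ∣v+s with p ∈? planPrimes
          ... | no  p∉plan = unplanned-prime-harmless pp p∉plan p∣u+r pᵇ∣v+s
          ... | yes p∈plan with t , t∈plan , refl ← ∈-map⁻ proj₁ p∈plan =
            planned-prime-harmless t∈plan circ p∣u+r pᵇ∣v+s

        cross-invisible : ∀ {i j} → P i j ≡ cross → Invisible b (u + (toℕ i + 1)) (v + (toℕ j + 1))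
        cross-invisible {i} {j} ij-cross visible
          with q , qij∈ ← ∈-freshPrimes⁺ w (∈-filter⁺ isCross? (∈-cartesianProduct⁺ (∈-allFin i) (∈-allFin j))
                                                      ij-cross) =
          visible⇒¬prime-divisor b visible (All.lookup plan-prime t∈plan) (u-solves t∈plan) (v-solves t∈plan)
          where
          t∈plan : (q , toℕ i + 1 , toℕ j + 1) ∈ plan
          t∈plan = ∈-++⁺ʳ smallTargets (∈-map⁺ _ qij∈)

        realizes : 0 < u → 0 < v → Realizable b w P
        realizes u>0 v>0 = u , v , u>0 , v>0 , λ i j → circle-visible , cross-invisible

    realizable : Realizable b w P
    realizable =
      let u , u>0 , u-solves = crt (map uCongruence plan) (All-map⁺ (All.map prime⇒nonZero plan-prime))
                                   (AllPairs.map⁺ plan-coprime)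
          v , v>0 , v-solves = crt (vSystem u u-solves) (vSystem-nonZero u u-solves) (vSystem-coprime u u-solves)
      in realizes u u-solves v v-solves u>0 v>0

mainTheorem4 : (b : ℕ) → 1 ≤ b → (w : ℕ) → 1 ≤ w → (P : Pattern b w) →
    Realizable b w P ⇔ (∀ (p : ℕ) → Prime p → ¬ ContainsCompleteRect b w P p)
mainTheorem4 b b≥1 w _ P =
  mk⇔ (realizable⇒¬complete {b} {w} P) (Construction.realizable {b} {w} P b≥1)
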